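{- Let $k\ge0$ and $N\ge1$ be integers. The PLRS generated by the $k+3$ coefficients $[1,1,\underbrace{0,\ldots,0}_{k},N]$ is complete if and only if $1\le N\le \left\lfloor (F_{k+6}-k-5)/4\right\rfloor$, where $\{F_n\}$ is the Fibonacci sequence indexed by $F_1=1$, $F_2=2$, $F_{n+1}=F_n+F_{n-1}$.
   Context: A positive linear recurrence sequence (PLRS) generated by coefficients $[c_1,\ldots,c_L]$ (with $L\ge1$, $c_i$ nonnegative integers, $c_1>0$, $c_L>0$) is the sequence $\{H_n\}_{n\ge1}$ defined by $H_1=1$; for $1\le n<L$, $H_{n+1}=c_1H_n+c_2H_{n-1}+\cdots+c_nH_1+1$; and for $n\ge L$, $H_{n+1}=c_1H_n+\cdots+c_LH_{n+1-L}$. A sequence of positive integers is complete if every positive integer is a sum of distinct terms of the sequence. -}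

module Defs where

open import Data.Nat using (ℕ; zero; suc; _+_; _*_; _<ᵇ_; _∸_; _/_)
open import Data.Bool using (if_then_else_)
open import Data.List using (List; []; _∷_; length; map; replicate; _++_)
open import Data.Nat.ListAction using (sum)
open import Data.List.Relation.Unary.Unique.Propositional using (Unique)
open import Data.List.Relation.Unary.All using (All)
open import Data.Nat using (_≤_; _≥_)
open import Data.Product using (∃; _×_)
open import Relation.Binary.PropositionalEquality using (_≡_)

dot : List ℕ → List ℕ → ℕ
dot (c ∷ cs) (h ∷ hs) = c * h + dot cs hs
dot _ _ = 0

-- prevs cs n = [H_n, H_{n-1}, …, H_1]  (the first n terms, reversed)
prevs : List ℕ → ℕ → List ℕ
prevs cs zero = []
prevs cs (suc zero) = 1 ∷ []
prevs cs (suc (suc n)) =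
  let hs = prevs cs (suc n) in
  (dot cs hs + (if suc n <ᵇ length cs then 1 else 0)) ∷ hs

-- H cs n = H_n for n ≥ 1 (H cs 0 = 0 is an unused dummy value)
H : List ℕ → ℕ → ℕ
H cs zero = 0
H cs (suc n) with prevs cs (suc n)
... | h ∷ _ = h
... | [] = 0

-- a sequence a : ℕ → ℕ (indexed from 1) is complete if every positive
-- integer is a sum of distinct terms: a sum over a duplicate-free finite
-- list of indices ≥ 1
Complete : (ℕ → ℕ) → Set
Complete a = ∀ m → m ≥ 1 →
  ∃ λ (is : List ℕ) → Unique is × All (λ i → i ≥ 1) is × sum (map a is) ≡ m

-- Fibonacci with F₁ = 1, F₂ = 2, F_{n+1} = F_n + F_{n-1} (F 0 = 1 is a dummy
-- value consistent with nothing used; only n ≥ 1 matters)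
F : ℕ → ℕ
F zero = 1
F (suc zero) = 1
F (suc (suc zero)) = 2
F (suc (suc (suc n))) = F (suc (suc n)) + F (suc n)

coeffs : ℕ → ℕ → List ℕ
coeffs k N = 1 ∷ 1 ∷ (replicate k 0 ++ (N ∷ []))

-- By Brown's criterion, a nondecreasing sequence with H₁ = 1 is complete iff
-- H_{n+1} ≤ 1 + H₁ + ⋯ + H_n for every n.  In the initial range the recurrence is
-- H_{n+2} = H_{n+1} + H_n + 1 and the criterion holds automatically; afterwards
-- H_{n+2} = H_{n+1} + H_n + N·H_{n-k-1}, and the criterion at n = m + k + 2 becomes the
-- tail bound N·H_m ≤ 1 + S_{m+k}.  Its right-hand side grows by a Fibonacci-type
-- recurrence with extra nonnegative terms, so the tail bound propagates by strong
-- induction (jointly with a strengthening that absorbs the N² term) once it holds at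
-- m = 3; for m ≤ 2 it follows from m = 3 by halving.  Finally H_n + 1 = F_{n+1} in the
-- initial range, which turns the bound at m = 3, 4N ≤ 1 + S_{k+3}, into
-- 4N ≤ F_{k+6} − k − 5.

module Submission where

open import Data.Bool using (if_then_else_)
open import Data.Bool.Properties using (T-≡; ¬-not)
open import Data.List using (List; []; _∷_; length; map; replicate; _++_; filter)
open import Data.List.Properties using (length-++; length-replicate; filter-accept; filter-reject; filter-all)
open import Data.List.Relation.Unary.All as All using (All; []; _∷_)
import Data.List.Relation.Unary.All.Properties as All
open import Data.List.Relation.Unary.AllPairs using ([]; _∷_)
open import Data.List.Relation.Unary.Unique.Propositional using (Unique)
import Data.List.Relation.Unary.Unique.Propositional.Properties as Unique
open import Data.Nat
open import Data.Nat.DivMod using (m*n/n≡m; m/n*n≤m; /-monoˡ-≤)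
open import Data.Nat.Induction using (<-rec)
open import Data.Nat.ListAction using (sum)
open import Data.Nat.Properties
open import Algebra.Properties.CommutativeSemigroup +-commutativeSemigroup using () renaming (x∙yz≈y∙xz to m+[n+o]≡n+[m+o])
open import Algebra.Properties.CommutativeSemigroup *-commutativeSemigroup using () renaming (x∙yz≈y∙xz to m*[n*o]≡n*[m*o])
open import Data.Nat.Tactic.RingSolver using (solve-∀)
open import Data.Product using (∃; _×_; _,_; proj₁; proj₂)
open import Data.Sum using (inj₁; inj₂)
open import Function.Bundles using (Equivalence; _⇔_; mk⇔)
open import Relation.Binary.PropositionalEquality
open import Relation.Nullary using (yes; no; ¬?; contradiction)
open import Defs

partialSum : (ℕ → ℕ) → ℕ → ℕ
partialSum a zero = 0
partialSum a (suc n) = partialSum a n + a (suc n)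

BrownCondition : (ℕ → ℕ) → ℕ → Set
BrownCondition a n = a (suc n) ≤ suc (partialSum a n)

DistinctSumBelow : (ℕ → ℕ) → ℕ → ℕ → Set
DistinctSumBelow a n m =
  ∃ λ (is : List ℕ) → Unique is × All (λ i → 1 ≤ i × i ≤ n) is × sum (map a is) ≡ m

module _ {a : ℕ → ℕ} where

  partialSum-≥ : (∀ n → 1 ≤ a (suc n)) → ∀ n → n ≤ partialSum a n
  partialSum-≥ pos zero = z≤n
  partialSum-≥ pos (suc n) = begin
    suc n                       ≡⟨ +-comm 1 n ⟩
    n + 1                       ≤⟨ +-mono-≤ (partialSum-≥ pos n) (pos n) ⟩
    partialSum a n + a (suc n)  ∎
    where open ≤-Reasoning

  brown⇒distinctSumBelow : (∀ n → BrownCondition a n) →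
                           ∀ n m → m ≤ partialSum a n → DistinctSumBelow a n m
  brown⇒distinctSumBelow brown zero .zero z≤n = [] , [] , [] , refl
  brown⇒distinctSumBelow brown (suc n) m m≤S with m ≤? partialSum a n
  ... | yes m≤Sn =
    let is , unique , bounds , sum≡m = brown⇒distinctSumBelow brown n m m≤Sn
    in  is , unique , All.map (λ (1≤i , i≤n) → 1≤i , m≤n⇒m≤1+n i≤n) bounds , sum≡m
  ... | no m≰Sn =
    let aₙ≤m = ≤-trans (brown n) (≰⇒> m≰Sn)
        rest≤Sn = m≤n+o⇒m∸n≤o m (a (suc n)) (≤-trans m≤S (≤-reflexive (+-comm (partialSum a n) _)))
        is , unique , bounds , sum≡rest = brown⇒distinctSumBelow brown n (m ∸ a (suc n)) rest≤Sn
    in  suc n ∷ is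
      , All.map (λ (_ , i≤n) → >⇒≢ (s≤s i≤n)) bounds ∷ unique
      , (s≤s z≤n , ≤-refl) ∷ All.map (λ (1≤i , i≤n) → 1≤i , m≤n⇒m≤1+n i≤n) bounds
      , trans (cong (a (suc n) +_) sum≡rest) (m+[n∸m]≡n aₙ≤m)

  brown⇒complete : (∀ n → 1 ≤ a (suc n)) → (∀ n → BrownCondition a n) → Complete a
  brown⇒complete pos brown m _ =
    let is , unique , bounds , sum≡m = brown⇒distinctSumBelow brown m m (partialSum-≥ pos m)
    in  is , unique , All.map proj₁ bounds , sum≡m

  private
    without : ℕ → List ℕ → List ℕ
    without x = filter (λ i → ¬? (x ≟ i))

    sum-without : ∀ x is → Unique is → sum (map a is) ≤ a x + sum (map a (without x is))
    sum-without x [] _ = z≤n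
    sum-without x (i ∷ is) (i∉is ∷ unique) with x ≟ i
    ... | yes refl rewrite filter-reject (λ i → ¬? (x ≟ i)) {x = x} {xs = is} (λ x≢x → x≢x refl)
                   | filter-all (λ i → ¬? (x ≟ i)) i∉is = ≤-refl
    ... | no x≢i rewrite filter-accept (λ i → ¬? (x ≟ i)) {x = i} {xs = is} x≢i =
      ≤-trans (+-monoʳ-≤ (a i) (sum-without x is unique)) (≤-reflexive (m+[n+o]≡n+[m+o] (a i) (a x) _))

  distinctSum≤partialSum : ∀ n is → Unique is → All (1 ≤_) is → All (_≤ n) is →
                           sum (map a is) ≤ partialSum a n
  distinctSum≤partialSum zero [] _ _ _ = z≤n
  distinctSum≤partialSum zero (i ∷ _) _ (1≤i ∷ _) (i≤0 ∷ _) = contradiction (≤-trans 1≤i i≤0) λ ()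
  distinctSum≤partialSum (suc n) is unique pos bounds = begin
    sum (map a is)                                       ≤⟨ sum-without (suc n) is unique ⟩
    a (suc n) + sum (map a (without (suc n) is))         ≤⟨ +-monoʳ-≤ (a (suc n)) rest≤Sₙ ⟩
    a (suc n) + partialSum a n                           ≡⟨ +-comm (a (suc n)) _ ⟩
    partialSum a (suc n)                                 ∎
    where
    open ≤-Reasoning
    ≢suc-n? = λ i → ¬? (suc n ≟ i)
    rest≤Sₙ = distinctSum≤partialSum n (without (suc n) is)
      (Unique.filter⁺ ≢suc-n? unique) (All.filter⁺ ≢suc-n? pos)
      (All.zipWith (λ (i≤1+n , 1+n≢i) → s≤s⁻¹ (≤∧≢⇒< i≤1+n (≢-sym 1+n≢i)))
                   (All.filter⁺ ≢suc-n? bounds , All.all-filter ≢suc-n? is))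

  complete⇒brown : (∀ {m n} → m ≤ n → a (suc m) ≤ a (suc n)) → Complete a → ∀ n → BrownCondition a n
  complete⇒brown mono complete n with a (suc n) ≤? suc (partialSum a n)
  ... | yes brown = brown
  ... | no ¬brown =
    let is , unique , pos , sum≡1+Sₙ = complete (suc (partialSum a n)) (s≤s z≤n)
        sum<aₙ = ≤-trans (s≤s (≤-reflexive sum≡1+Sₙ)) (≰⇒> ¬brown)
    in  contradiction (distinctSum≤partialSum n is unique pos (indices≤ is pos sum<aₙ))
                      (<⇒≱ (≤-reflexive (sym sum≡1+Sₙ)))
    where
    indices≤ : ∀ is → All (1 ≤_) is → sum (map a is) < a (suc n) → All (_≤ n) is
    indices≤ [] [] _ = []
    indices≤ (i ∷ is) (s≤s _ ∷ pos) sum<aₙ with i ≤? n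
    ... | yes i≤n = i≤n ∷ indices≤ is pos (≤-<-trans (m≤n+m _ (a i)) sum<aₙ)
    ... | no i≰n = contradiction (mono (s≤s⁻¹ (≰⇒> i≰n))) (<⇒≱ (≤-<-trans (m≤m+n (a i) _) sum<aₙ))

m*n≤o⇔m≤o/n : ∀ m n o .{{_ : NonZero n}} → m * n ≤ o ⇔ m ≤ o / n
m*n≤o⇔m≤o/n m n o = mk⇔
  (λ m*n≤o → ≤-trans (≤-reflexive (sym (m*n/n≡m m n))) (/-monoˡ-≤ n m*n≤o))
  (λ m≤o/n → ≤-trans (*-monoˡ-≤ n m≤o/n) (m/n*n≤m o n))

-- For k ≤ 2 the strengthened tail bound at the first few indices m ≥ 2 + k does not
-- follow from the recursion; these are the instances the Fibonacci bound supplies.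
SmallCases : ℕ → ℕ → Set
SmallCases k N = (k ≤ 1 → N ≤ 2 + k) × (k ≤ 2 → N ≤ (2 + k) + (2 + k))

module Sequence (k N : ℕ) where

  h : ℕ → ℕ
  h = H (coeffs k N)

  S : ℕ → ℕ
  S = partialSum h

  history : ℕ → List ℕ
  history zero = []
  history (suc n) = h (suc n) ∷ history n

  prevs≡history : ∀ n → prevs (coeffs k N) n ≡ history n
  prevs≡history zero = refl
  prevs≡history (suc zero) = refl
  prevs≡history (suc (suc n)) = cong (h (2 + n) ∷_) (prevs≡history (suc n))

  dot-[] : ∀ cs → dot cs [] ≡ 0
  dot-[] [] = refl
  dot-[] (_ ∷ _) = refl

  dot-∷ : ∀ c cs j → dot (c ∷ cs) (history j) ≡ c * h j + dot cs (history (pred j))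
  dot-∷ c cs zero = sym (cong₂ _+_ (*-zeroʳ c) (dot-[] cs))
  dot-∷ c cs (suc j) = refl

  dot-lag : ∀ c lag j → dot (replicate lag 0 ++ c ∷ []) (history j) ≡ c * h (j ∸ lag)
  dot-lag c zero j = trans (dot-∷ c [] j) (+-identityʳ (c * h j))
  dot-lag c (suc lag) zero = sym (*-zeroʳ c)
  dot-lag c (suc lag) (suc j) = dot-lag c lag j

  length-coeffs : length (coeffs k N) ≡ 3 + k
  length-coeffs = cong (2 +_) (begin
    length (replicate k 0 ++ N ∷ [])  ≡⟨ length-++ (replicate k 0) ⟩
    length (replicate k 0) + 1        ≡⟨ cong (_+ 1) (length-replicate k) ⟩
    k + 1                             ≡⟨ +-comm k 1 ⟩
    suc k                             ∎)
    where open ≡-Reasoning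

  initialOne : ℕ → ℕ
  initialOne n = if suc n <ᵇ length (coeffs k N) then 1 else 0

  initialOne-initial : ∀ {n} → n ≤ suc k → initialOne n ≡ 1
  initialOne-initial {n} n≤1+k = trans (cong (λ L → if suc n <ᵇ L then 1 else 0) length-coeffs)
    (cong (λ b → if b then 1 else 0) (Equivalence.to T-≡ (<⇒<ᵇ (s≤s (s≤s n≤1+k)))))

  initialOne-tail : ∀ {n} → 2 + k ≤ n → initialOne n ≡ 0
  initialOne-tail {n} 2+k≤n = trans (cong (λ L → if suc n <ᵇ L then 1 else 0) length-coeffs)
    (cong (λ b → if b then 1 else 0)
          (¬-not (λ t → <⇒≱ (<ᵇ⇒< _ _ (Equivalence.from T-≡ t)) (s≤s 2+k≤n))))

  h-unfold : ∀ n → h (2 + n) ≡ h (1 + n) + (h n + N * h (pred n ∸ k)) + initialOne n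
  h-unfold n = begin
    h (2 + n)                                          ≡⟨ cong (λ hs → dot (coeffs k N) hs + initialOne n) (prevs≡history (suc n)) ⟩
    1 * h (1 + n) + dot (1 ∷ replicate k 0 ++ N ∷ []) (history n) + initialOne n
                                                       ≡⟨ cong (λ d → 1 * h (1 + n) + d + initialOne n) (dot-∷ 1 _ n) ⟩
    1 * h (1 + n) + (1 * h n + dot (replicate k 0 ++ N ∷ []) (history (pred n))) + initialOne n
                                                       ≡⟨ cong₂ (λ a b → a + b + initialOne n) (*-identityˡ (h (1 + n))) (cong₂ _+_ (*-identityˡ (h n)) (dot-lag N k (pred n))) ⟩
    h (1 + n) + (h n + N * h (pred n ∸ k)) + initialOne n ∎
    where open ≡-Reasoning

  h-rec-initial : ∀ n → n ≤ suc k → h (2 + n) ≡ h (1 + n) + h n + 1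
  h-rec-initial n n≤1+k = begin
    h (2 + n)                                               ≡⟨ h-unfold n ⟩
    h (1 + n) + (h n + N * h (pred n ∸ k)) + initialOne n   ≡⟨ cong₂ (λ l o → h (1 + n) + (h n + N * h l) + o)
                                                                     (m≤n⇒m∸n≡0 (pred-mono-≤ n≤1+k)) (initialOne-initial n≤1+k) ⟩
    h (1 + n) + (h n + N * 0) + 1                           ≡⟨ cong (λ x → h (1 + n) + x + 1) (trans (cong (h n +_) (*-zeroʳ N)) (+-identityʳ (h n))) ⟩
    h (1 + n) + h n + 1                                     ∎
    where open ≡-Reasoning

  h-rec-tail : ∀ j → h (4 + (j + k)) ≡ h (3 + (j + k)) + h (2 + (j + k)) + N * h (suc j)
  h-rec-tail j = begin
    h (4 + (j + k))                                                         ≡⟨ h-unfold (2 + (j + k)) ⟩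
    h (3 + (j + k)) + (h (2 + (j + k)) + N * h (suc (j + k) ∸ k)) + initialOne (2 + (j + k))
                                                                            ≡⟨ cong₂ (λ l o → h (3 + (j + k)) + (h (2 + (j + k)) + N * h l) + o)
                                                                                      (m+n∸n≡m (suc j) k) (initialOne-tail (s≤s (s≤s (m≤n+m k j)))) ⟩
    h (3 + (j + k)) + (h (2 + (j + k)) + N * h (suc j)) + 0                 ≡⟨ +-identityʳ _ ⟩
    h (3 + (j + k)) + (h (2 + (j + k)) + N * h (suc j))                     ≡⟨ +-assoc (h (3 + (j + k))) _ _ ⟨
    h (3 + (j + k)) + h (2 + (j + k)) + N * h (suc j)                       ∎
    where open ≡-Reasoning

  h-mono : ∀ {m n} → m ≤ n → h (suc m) ≤ h (suc n)
  h-mono {n = zero} z≤n = ≤-refl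
  h-mono {m} {suc n} m≤1+n with m≤n⇒m<n∨m≡n m≤1+n
  ... | inj₂ refl = ≤-refl
  ... | inj₁ m<1+n = ≤-trans (h-mono (s≤s⁻¹ m<1+n))
                             (≤-trans (≤-trans (m≤m+n _ _) (m≤m+n _ _)) (≤-reflexive (sym (h-unfold n))))

  h-positive : ∀ n → 1 ≤ h (suc n)
  h-positive n = h-mono {n = n} z≤n

  h-initial-closed : ∀ j → j ≤ suc k → h (2 + j) ≡ S j + (2 + j)
  h-initial-closed zero _ = h-rec-initial 0 z≤n
  h-initial-closed (suc j) 1+j≤1+k = begin
    h (3 + j)                        ≡⟨ h-rec-initial (suc j) 1+j≤1+k ⟩
    h (2 + j) + h (1 + j) + 1        ≡⟨ cong (λ x → x + h (1 + j) + 1) (h-initial-closed j (<⇒≤ 1+j≤1+k)) ⟩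
    S j + (2 + j) + h (1 + j) + 1    ≡⟨ rearrange (S j) j (h (1 + j)) ⟩
    S j + h (1 + j) + (3 + j)        ∎
    where
    open ≡-Reasoning
    rearrange : ∀ s j x → s + (2 + j) + x + 1 ≡ s + x + (3 + j)
    rearrange = solve-∀

  h-closed : ∀ m → h (3 + (m + k)) ≡ S (1 + (m + k)) + (3 + k) + N * S m
  h-closed zero = begin
    h (3 + k)                          ≡⟨ h-initial-closed (suc k) ≤-refl ⟩
    S (1 + k) + (3 + k)                ≡⟨ +-identityʳ _ ⟨
    S (1 + k) + (3 + k) + 0            ≡⟨ cong (S (1 + k) + (3 + k) +_) (*-zeroʳ N) ⟨
    S (1 + k) + (3 + k) + N * S 0      ∎
    where open ≡-Reasoning
  h-closed (suc m) = begin
    h (4 + (m + k))                                                          ≡⟨ h-rec-tail m ⟩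
    h (3 + (m + k)) + h (2 + (m + k)) + N * h (suc m)                        ≡⟨ cong (λ x → x + h (2 + (m + k)) + N * h (suc m)) (h-closed m) ⟩
    S (1 + (m + k)) + (3 + k) + N * S m + h (2 + (m + k)) + N * h (suc m)    ≡⟨ rearrange (S (1 + (m + k))) (3 + k) N (S m) (h (2 + (m + k))) (h (suc m)) ⟩
    S (2 + (m + k)) + (3 + k) + N * S (suc m)                                ∎
    where
    open ≡-Reasoning
    rearrange : ∀ s c n t x y → s + c + n * t + x + n * y ≡ s + x + c + n * (t + y)
    rearrange = solve-∀

  h≤S : ∀ n → h n ≤ S n
  h≤S zero = z≤n
  h≤S (suc n) = m≤n+m (h (suc n)) (S n)

  brown-initial : ∀ n → n ≤ 2 + k → BrownCondition h n
  brown-initial zero _ = ≤-refl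
  brown-initial (suc n) 1+n≤2+k = begin
    h (2 + n)               ≡⟨ h-rec-initial n (s≤s⁻¹ 1+n≤2+k) ⟩
    h (1 + n) + h n + 1     ≤⟨ +-monoˡ-≤ 1 (+-monoʳ-≤ (h (1 + n)) (h≤S n)) ⟩
    h (1 + n) + S n + 1     ≡⟨ +-comm (h (1 + n) + S n) 1 ⟩
    suc (h (1 + n) + S n)   ≡⟨ cong suc (+-comm (h (1 + n)) (S n)) ⟩
    suc (S (1 + n))         ∎
    where open ≤-Reasoning

  budget : ℕ → ℕ
  budget m = suc (S (m + k))

  TailBound : ℕ → Set
  TailBound m = N * h m ≤ budget m

  StrongTailBound : ℕ → Set
  StrongTailBound m = N * h m + N ≤ budget m + (2 + k)

  budget-rec : ∀ i → budget (3 + i) ≡ budget (2 + i) + budget (1 + i) + (2 + k) + N * S i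
  budget-rec i = begin
    suc (S (2 + (i + k)) + h (3 + (i + k)))                         ≡⟨ cong (λ x → suc (S (2 + (i + k)) + x)) (h-closed i) ⟩
    suc (S (2 + (i + k)) + (S (1 + (i + k)) + (3 + k) + N * S i))   ≡⟨ rearrange (S (2 + (i + k))) (S (1 + (i + k))) k (N * S i) ⟩
    budget (2 + i) + budget (1 + i) + (2 + k) + N * S i             ∎
    where
    open ≡-Reasoning
    rearrange : ∀ s t k x → suc (s + (t + (3 + k) + x)) ≡ suc s + suc t + (2 + k) + x
    rearrange = solve-∀

  brown⇔tailBound : ∀ j → BrownCondition h (3 + (j + k)) ⇔ TailBound (suc j)
  brown⇔tailBound j = mk⇔
    (λ brown → +-cancelˡ-≤ (x + y) _ _ (≤-trans (≤-reflexive (sym (h-rec-tail j))) (≤-trans brown (≤-reflexive (e (S (1 + (j + k))) y x)))))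
    (λ tail → ≤-trans (≤-reflexive (h-rec-tail j)) (≤-trans (+-monoʳ-≤ (x + y) tail) (≤-reflexive (sym (e (S (1 + (j + k))) y x)))))
    where
    x = h (3 + (j + k))
    y = h (2 + (j + k))
    e : ∀ s y x → suc (s + y + x) ≡ x + y + suc s
    e = solve-∀

  tailBound-initial : ∀ i → i ≤ k → N ≤ (2 + k) + N * S i →
                      TailBound (2 + i) → TailBound (1 + i) → TailBound (3 + i)
  tailBound-initial i i≤k N≤ p₂ p₁ = begin
    N * h (3 + i)                                          ≡⟨ cong (N *_) (h-rec-initial (suc i) (s≤s i≤k)) ⟩
    N * (h (2 + i) + h (1 + i) + 1)                        ≡⟨ distrib N (h (2 + i)) (h (1 + i)) ⟩
    N * h (2 + i) + N * h (1 + i) + N                      ≤⟨ +-mono-≤ (+-mono-≤ p₂ p₁) N≤ ⟩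
    budget (2 + i) + budget (1 + i) + ((2 + k) + N * S i)  ≡⟨ +-assoc (budget (2 + i) + budget (1 + i)) _ _ ⟨
    budget (2 + i) + budget (1 + i) + (2 + k) + N * S i    ≡⟨ budget-rec i ⟨
    budget (3 + i)                                         ∎
    where
    open ≤-Reasoning
    distrib : ∀ n a b → n * (a + b + 1) ≡ n * a + n * b + n
    distrib = solve-∀

  strongTailBound-initial : ∀ i → i ≤ k → N + N ≤ (2 + k) + (2 + k) + N * S i →
                            TailBound (2 + i) → TailBound (1 + i) → StrongTailBound (3 + i)
  strongTailBound-initial i i≤k 2N≤ p₂ p₁ = begin
    N * h (3 + i) + N                                                   ≡⟨ cong (λ x → N * x + N) (h-rec-initial (suc i) (s≤s i≤k)) ⟩
    N * (h (2 + i) + h (1 + i) + 1) + N                                 ≡⟨ distrib N (h (2 + i)) (h (1 + i)) ⟩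
    N * h (2 + i) + N * h (1 + i) + (N + N)                             ≤⟨ +-mono-≤ (+-mono-≤ p₂ p₁) 2N≤ ⟩
    budget (2 + i) + budget (1 + i) + ((2 + k) + (2 + k) + N * S i)     ≡⟨ rearrange (budget (2 + i) + budget (1 + i)) (2 + k) (N * S i) ⟩
    budget (2 + i) + budget (1 + i) + (2 + k) + N * S i + (2 + k)       ≡⟨ cong (_+ (2 + k)) (budget-rec i) ⟨
    budget (3 + i) + (2 + k)                                            ∎
    where
    open ≤-Reasoning
    distrib : ∀ n a b → n * (a + b + 1) + n ≡ n * a + n * b + (n + n)
    distrib = solve-∀
    rearrange : ∀ b c x → b + (c + c + x) ≡ b + c + x + c
    rearrange = solve-∀

  tailBound-tail : ∀ j → let i = suc j + k in
                   TailBound (2 + i) → StrongTailBound (1 + i) → TailBound (suc j) → TailBound (3 + i)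
  tailBound-tail j p₂ q₁ pⱼ = +-cancelʳ-≤ N _ _ (begin
    N * h (3 + i) + N                                            ≡⟨ cong (λ x → N * x + N) (h-rec-tail j) ⟩
    N * (h (2 + i) + h (1 + i) + N * h (suc j)) + N              ≡⟨ distrib N (h (2 + i)) (h (1 + i)) (h (suc j)) ⟩
    N * h (2 + i) + (N * h (1 + i) + N) + N * (N * h (suc j))    ≤⟨ +-mono-≤ (+-mono-≤ p₂ q₁) (*-monoʳ-≤ N pⱼ) ⟩
    budget (2 + i) + (budget (1 + i) + (2 + k)) + N * suc (S i)  ≡⟨ rearrange (budget (2 + i)) (budget (1 + i)) (2 + k) N (S i) ⟩
    budget (2 + i) + budget (1 + i) + (2 + k) + N * S i + N      ≡⟨ cong (_+ N) (budget-rec i) ⟨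
    budget (3 + i) + N                                           ∎)
    where
    i = suc j + k
    open ≤-Reasoning
    distrib : ∀ n a b c → n * (a + b + n * c) + n ≡ n * a + (n * b + n) + n * (n * c)
    distrib = solve-∀
    rearrange : ∀ b₂ b₁ c n s → b₂ + (b₁ + c) + n * suc s ≡ b₂ + b₁ + c + n * s + n
    rearrange = solve-∀

  strongTailBound-tail : ∀ j → let i = suc j + k in
                         StrongTailBound (2 + i) → StrongTailBound (1 + i) → TailBound (suc j) → StrongTailBound (3 + i)
  strongTailBound-tail j q₂ q₁ pⱼ = +-cancelʳ-≤ N _ _ (begin
    N * h (3 + i) + N + N                                                  ≡⟨ cong (λ x → N * x + N + N) (h-rec-tail j) ⟩
    N * (h (2 + i) + h (1 + i) + N * h (suc j)) + N + N                    ≡⟨ distrib N (h (2 + i)) (h (1 + i)) (h (suc j)) ⟩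
    N * h (2 + i) + N + (N * h (1 + i) + N) + N * (N * h (suc j))          ≤⟨ +-mono-≤ (+-mono-≤ q₂ q₁) (*-monoʳ-≤ N pⱼ) ⟩
    budget (2 + i) + (2 + k) + (budget (1 + i) + (2 + k)) + N * suc (S i)  ≡⟨ rearrange (budget (2 + i)) (budget (1 + i)) (2 + k) N (S i) ⟩
    budget (2 + i) + budget (1 + i) + (2 + k) + N * S i + (2 + k) + N      ≡⟨ cong (λ b → b + (2 + k) + N) (budget-rec i) ⟨
    budget (3 + i) + (2 + k) + N                                           ∎)
    where
    i = suc j + k
    open ≤-Reasoning
    distrib : ∀ n a b c → n * (a + b + n * c) + n + n ≡ n * a + n + (n * b + n) + n * (n * c)
    distrib = solve-∀
    rearrange : ∀ b₂ b₁ c n s → b₂ + c + (b₁ + c) + n * suc s ≡ b₂ + b₁ + c + n * s + c + n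
    rearrange = solve-∀

  h-2 : h 2 ≡ 2 * h 1
  h-2 = h-rec-initial 0 z≤n

  h-3 : h 3 ≡ 2 * h 2
  h-3 = trans (h-rec-initial 1 (s≤s z≤n)) (cong (λ x → x + 1 + 1) h-2)

  -- budget (2 + m) = budget (1 + m) + h (2 + m + k) ≤ 2 · budget (1 + m) by the criterion.
  tailBound-halve : ∀ m → m ≤ 1 → h (2 + m) ≡ 2 * h (1 + m) → TailBound (2 + m) → TailBound (1 + m)
  tailBound-halve m m≤1 h-double p = *-cancelˡ-≤ 2 (begin
    2 * (N * h (1 + m))                           ≡⟨ m*[n*o]≡n*[m*o] 2 N (h (1 + m)) ⟩
    N * (2 * h (1 + m))                           ≡⟨ cong (N *_) h-double ⟨
    N * h (2 + m)                                 ≤⟨ p ⟩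
    budget (1 + m) + h (2 + (m + k))              ≤⟨ +-monoʳ-≤ (budget (1 + m)) (brown-initial (1 + (m + k)) (s≤s (+-monoˡ-≤ k m≤1))) ⟩
    budget (1 + m) + budget (1 + m)               ≡⟨ cong (budget (1 + m) +_) (+-identityʳ _) ⟨
    2 * budget (1 + m)                            ∎)
    where open ≤-Reasoning

  data Phase : ℕ → Set where
    initial : ∀ {i} → i ≤ k → Phase i
    tail : ∀ j → Phase (suc j + k)

  phase : ∀ i → Phase i
  phase i with i ≤? k
  ... | yes i≤k = initial i≤k
  ... | no i≰k = let j , k+1+j≡i = m≤n⇒∃[o]m+o≡n (≰⇒> i≰k)
                 in subst Phase (trans (cong suc (+-comm j k)) k+1+j≡i) (tail j)

  N≤N*S : ∀ {c} i → c ≤ i → N * c ≤ N * S i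
  N≤N*S i c≤i = *-monoʳ-≤ N (≤-trans c≤i (partialSum-≥ h-positive i))

  module _ (small : SmallCases k N) (tail₃ : TailBound 3) where

    Bounds : ℕ → Set
    Bounds m = TailBound m × (2 + k ≤ m → StrongTailBound m)

    tail₂ : TailBound 2
    tail₂ = tailBound-halve 1 (s≤s z≤n) h-3 tail₃

    strongTailBound-small : ∀ m → k ≤ 1 → TailBound m → StrongTailBound m
    strongTailBound-small _ k≤1 p = +-mono-≤ p (proj₁ small k≤1)

    bounds-step : ∀ m → (∀ {m′} → m′ < m → Bounds m′) → Bounds m
    bounds-step 0 _ = ≤-trans (≤-reflexive (*-zeroʳ N)) z≤n , λ ()
    bounds-step 1 _ = tailBound-halve 0 z≤n h-2 tail₂ , λ { (s≤s ()) }
    bounds-step 2 _ = tail₂ , λ 2+k≤2 → strongTailBound-small 2 (≤-trans (s≤s⁻¹ (s≤s⁻¹ 2+k≤2)) z≤n) tail₂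
    bounds-step 3 _ = tail₃ , λ 2+k≤3 → strongTailBound-small 3 (s≤s⁻¹ (s≤s⁻¹ 2+k≤3)) tail₃
    bounds-step (suc (suc (suc (suc i′)))) rec with phase (suc i′)
    ... | initial i≤k = tailBound-initial i i≤k N≤ p₂ p₁ , λ 2+k≤3+i → strongTailBound-initial i i≤k (2N≤ i′ 2+k≤3+i) p₂ p₁
      where
      i = suc i′
      p₂ = proj₁ (rec (n<1+n (2 + i)))
      p₁ = proj₁ (rec (m<n⇒m<1+n (n<1+n (1 + i))))
      N≤ : N ≤ (2 + k) + N * S i
      N≤ = ≤-trans (≤-reflexive (sym (*-identityʳ N))) (≤-trans (N≤N*S i (s≤s z≤n)) (m≤n+m _ _))
      2N≤ : ∀ i′ → 2 + k ≤ 4 + i′ → N + N ≤ (2 + k) + (2 + k) + N * S (suc i′)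
      2N≤ zero 2+k≤4 = +-mono-≤ (proj₂ small (s≤s⁻¹ (s≤s⁻¹ 2+k≤4))) (≤-reflexive (sym (*-identityʳ N)))
      2N≤ (suc i″) _ = ≤-trans (≤-reflexive (n+n≡n*2 N)) (≤-trans (N≤N*S (2 + i″) (s≤s (s≤s z≤n))) (m≤n+m _ _))
        where
        n+n≡n*2 : ∀ n → n + n ≡ n * 2
        n+n≡n*2 = solve-∀
    ... | tail j = tailBound-tail j p₂ q₁ pⱼ , λ _ → strongTailBound-tail j q₂ q₁ pⱼ
      where
      2+k≤2+j+k : 2 + k ≤ 2 + (j + k)
      2+k≤2+j+k = s≤s (s≤s (m≤n+m k j))
      bounds₂ = rec (n<1+n (3 + (j + k)))
      bounds₁ = rec (m<n⇒m<1+n (n<1+n (2 + (j + k))))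
      p₂ = proj₁ bounds₂
      q₂ = proj₂ bounds₂ (m≤n⇒m≤1+n 2+k≤2+j+k)
      q₁ = proj₂ bounds₁ 2+k≤2+j+k
      pⱼ = proj₁ (rec {suc j} (s≤s (≤-trans (s≤s (m≤m+n j k)) (m≤n+m _ 2))))

    tailBound : ∀ m → TailBound m
    tailBound m = proj₁ (<-rec Bounds bounds-step m)

    tailBound₃⇒complete : Complete h
    tailBound₃⇒complete = brown⇒complete h-positive brown
      where
      brown : ∀ n → BrownCondition h n
      brown 0 = brown-initial 0 z≤n
      brown 1 = brown-initial 1 (s≤s z≤n)
      brown (suc (suc i)) with phase i
      ... | initial i≤k = brown-initial (2 + i) (s≤s (s≤s i≤k))
      ... | tail j = Equivalence.from (brown⇔tailBound j) (tailBound (suc j))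

  complete⇒tailBound₃ : Complete h → TailBound 3
  complete⇒tailBound₃ complete = Equivalence.to (brown⇔tailBound 2) (complete⇒brown h-mono complete (5 + k))

  h+1≡F : ∀ i → i ≤ 2 + k → h (1 + i) + 1 ≡ F (2 + i)
  h+1≡F 0 _ = refl
  h+1≡F 1 _ = cong (_+ 1) h-2
  h+1≡F (suc (suc i)) 2+i≤2+k = begin
    h (3 + i) + 1                      ≡⟨ cong (_+ 1) (h-rec-initial (suc i) 1+i≤1+k) ⟩
    h (2 + i) + h (1 + i) + 1 + 1      ≡⟨ rearrange (h (2 + i)) (h (1 + i)) ⟩
    (h (2 + i) + 1) + (h (1 + i) + 1)  ≡⟨ cong₂ _+_ (h+1≡F (suc i) (m≤n⇒m≤1+n 1+i≤1+k)) (h+1≡F i (≤-trans (n≤1+n i) (m≤n⇒m≤1+n 1+i≤1+k))) ⟩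
    F (4 + i)                          ∎
    where
    open ≡-Reasoning
    1+i≤1+k = s≤s⁻¹ 2+i≤2+k
    rearrange : ∀ a b → a + b + 1 + 1 ≡ (a + 1) + (b + 1)
    rearrange = solve-∀

  S+≡F : ∀ j → j ≤ 3 + k → S j + (3 + j) ≡ F (3 + j)
  S+≡F 0 _ = refl
  S+≡F (suc j) 1+j≤3+k = begin
    S j + h (1 + j) + (4 + j)          ≡⟨ rearrange (S j) (h (1 + j)) j ⟩
    (S j + (3 + j)) + (h (1 + j) + 1)  ≡⟨ cong₂ _+_ (S+≡F j (<⇒≤ 1+j≤3+k)) (h+1≡F j (s≤s⁻¹ 1+j≤3+k)) ⟩
    F (4 + j)                          ∎
    where
    open ≡-Reasoning
    rearrange : ∀ s a j → s + a + (4 + j) ≡ (s + (3 + j)) + (a + 1)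
    rearrange = solve-∀

  budget₃≡F : budget 3 ≡ F (k + 6) ∸ (k + 5)
  budget₃≡F = sym (begin
    F (k + 6) ∸ (k + 5)                    ≡⟨ cong (λ n → F n ∸ (k + 5)) (+-comm k 6) ⟩
    F (3 + (3 + k)) ∸ (k + 5)              ≡⟨ cong (_∸ (k + 5)) (S+≡F (3 + k) ≤-refl) ⟨
    S (3 + k) + (3 + (3 + k)) ∸ (k + 5)    ≡⟨ cong (_∸ (k + 5)) (rearrange (S (3 + k)) k) ⟩
    budget 3 + (k + 5) ∸ (k + 5)           ≡⟨ m+n∸n≡m (budget 3) (k + 5) ⟩
    budget 3                               ∎)
    where
    open ≡-Reasoning
    rearrange : ∀ s k → s + (3 + (3 + k)) ≡ suc s + (k + 5)
    rearrange = solve-∀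

  tailBound₃⇔ : TailBound 3 ⇔ N ≤ (F (k + 6) ∸ (k + 5)) / 4
  tailBound₃⇔ rewrite trans h-3 (cong (2 *_) h-2) | budget₃≡F = m*n≤o⇔m≤o/n N 4 _

fibonacciBound⇒smallCases : ∀ k N → N ≤ (F (k + 6) ∸ (k + 5)) / 4 → SmallCases k N
fibonacciBound⇒smallCases 0 N N≤2 = (λ _ → N≤2) , λ _ → ≤-trans N≤2 (m≤m+n 2 2)
fibonacciBound⇒smallCases 1 N N≤3 = (λ _ → N≤3) , λ _ → ≤-trans N≤3 (m≤m+n 3 3)
fibonacciBound⇒smallCases 2 N N≤6 = (λ { (s≤s ()) }) , λ _ → ≤-trans N≤6 (m≤m+n 6 2)
fibonacciBound⇒smallCases (suc (suc (suc k))) N _ = (λ { (s≤s ()) }) , λ { (s≤s (s≤s ())) }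

mainTheorem6 : (k N : ℕ) → 1 ≤ N →
    Complete (H (coeffs k N)) ⇔ (1 ≤ N × N ≤ (F (k + 6) ∸ (k + 5)) / 4)
mainTheorem6 k N 1≤N = mk⇔
  (λ complete → 1≤N , Equivalence.to tailBound₃⇔ (complete⇒tailBound₃ complete))
  (λ (_ , N≤) → tailBound₃⇒complete (fibonacciBound⇒smallCases k N N≤) (Equivalence.from tailBound₃⇔ N≤))
  where open Sequence k N
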